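{- Let $s\ge2$ and $n\ge1$, and consider the nondeterministic substitution automaton $\mathcal{A}$ with states $q_0,\ldots,q_{s-1}$ described in the context. Let $m=x_{t_1}x_{t_2}\cdots x_{t_D}$ be a non-empty monomial over $X=\{x_1,\ldots,x_n\}$ and let $\rho$ be a path of $\mathcal{A}$ from $q_0$ to $q_{s-1}$ labelled by $m$. Then the transformed monomial $m_\rho$ can be expressed in the form $m_\rho=c_m\cdot m'_1\cdot m'_2\cdots m'_N$, where $N\ge1$, $c_m$ is a monomial over the commuting variables $Y\sqcup Z$, and each $m'_\ell$ has the form $m'_\ell=\xi_1^{\ell_1}\xi_2^{\ell_2}\cdots\xi_s^{\ell_s}$ with $\ell_k>0$ for all $k\in[s-1]$ and $\ell_s\ge0$.
   Context: Let $Z=\{z_1,\ldots,z_n\}$ and $Y=\{y_{k,t}: k\in[s-1],t\in[n]\}$ be commuting variables, and $\xi=\{\xi_1,\ldots,\xi_s\}$ non-commuting variables; variables of $Y\sqcup Z$ commute with everything. The automaton $\mathcal{A}$ has, for each input variable $x_t$ ($t\in[n]$), the following transitions (each reading $x_t$ and outputting the indicated label): a loop $q_k\to q_k$ with label $z_t\xi_{k+1}$ for each $0\le k\le s-1$; a transition $q_{k-1}\to q_k$ with label $y_{k,t}\xi_k$ for each $1\le k\le s-1$; a transition $q_{s-2}\to q_0$ with label $y_{s-1,t}\xi_{s-1}$; and a transition $q_{s-1}\to q_0$ with label $z_t\xi_s$. A path labelled by $m=x_{t_1}\cdots x_{t_D}$ is a sequence of $D$ consecutive transitions, the $p$-th being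 a transition for $x_{t_p}$; the transformed monomial $m_\rho\in\mathbb{F}[Y\sqcup Z]\langle\xi\rangle$ is the product, in order, of the labels of the transitions of $\rho$. -}

module Defs where

open import Data.Nat using (ℕ; zero; suc; _+_; _∸_; _≤_; _<_)
open import Data.Fin using (Fin)
open import Data.List using (List; []; _∷_; _++_; map; replicate; concat; length; take)
open import Data.List.Relation.Unary.All using (All)
open import Data.List.Relation.Binary.Permutation.Propositional using (_↭_)
open import Data.Product using (_×_; _,_; proj₁; proj₂)
open import Relation.Binary.PropositionalEquality using (_≡_)

-- Commuting variables Y ⊔ Z.  yv k t is y_{k,t} (k ∈ [s-1] by construction),
-- zv t is z_t.  Input letters x_t are indices t : Fin n.
data CVar (n : ℕ) : Set where
  yv : ℕ → Fin n → CVar n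
  zv : Fin n → CVar n

-- A transition label  (commuting variable , index k of ξ_k), k ∈ [s].
Label : ℕ → Set
Label n = CVar n × ℕ

-- Transitions of the automaton A (states q_0..q_{s-1} are the naturals 0..s-1):
-- Step s n q t q' l : a transition q → q' reading x_t with output label l.
data Step (s n : ℕ) : ℕ → Fin n → ℕ → Label n → Set where
  loop  : ∀ {k t} → k < s → Step s n k t k (zv t , suc k)
  fwd   : ∀ {j t} → suc j ≤ s ∸ 1 → Step s n j t (suc j) (yv (suc j) t , suc j)
  back1 : ∀ {t} → Step s n (s ∸ 2) t 0 (yv (s ∸ 1) t , s ∸ 1)
  back2 : ∀ {t} → Step s n (s ∸ 1) t 0 (zv t , s)

data Path (s n : ℕ) : ℕ → List (Fin n) → ℕ → Set where
  []  : ∀ {q} → Path s n q [] q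
  _∷_ : ∀ {q t q' q'' w l} → Step s n q t q' l → Path s n q' w q'' → Path s n q (t ∷ w) q''

-- Monomials of F[Y ⊔ Z]⟨ξ⟩: a commutative monomial (multiset of commuting
-- variables, as a list) together with a word in the ξ's (list of indices).
Mono : ℕ → Set
Mono n = List (CVar n) × List ℕ

_≈M_ : ∀ {n} → Mono n → Mono n → Set
(c , u) ≈M (d , v) = (c ↭ d) × (u ≡ v)

-- Product of monomials (Y ⊔ Z commute with everything).
_·M_ : ∀ {n} → Mono n → Mono n → Mono n
(c , u) ·M (d , v) = (c ++ d , u ++ v)

labelMono : ∀ {n} → Label n → Mono n
labelMono (c , k) = (c ∷ [] , k ∷ [])

transformed : ∀ {s n q m q'} → Path s n q m q' → Mono n
transformed [] = ([] , [])
transformed (_∷_ {l = l} st ρ) = labelMono l ·M transformed ρ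

blockWordFrom : ℕ → List ℕ → List ℕ
blockWordFrom k [] = []
blockWordFrom k (l ∷ ls) = replicate l k ++ blockWordFrom (suc k) ls

blockWord : List ℕ → List ℕ
blockWord ls = blockWordFrom 1 ls

Admissible : ℕ → List ℕ → Set
Admissible s ls = (length ls ≡ s) × All (0 <_) (take (s ∸ 1) ls)

{-# OPTIONS --safe #-}
-- Read a path backwards from q_{s-1}.  The ξ-word of a path starting in q_q is a
-- partial block ξ_{q+1}^{ℓ_{q+1}} ⋯ ξ_s^{ℓ_s} with ℓ_{q+1}, …, ℓ_{s-1} > 0, followed by
-- complete blocks.  A loop at q_q raises ℓ_{q+1}, an edge q_q → q_{q+1} prepends a new
-- exponent 1, and an edge back to q_0 turns the partial block of q_0 (which is complete)
-- into a block and opens the partial block ξ_{s-1} resp. ξ_s.  At q_0 the partial block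
-- is the first complete block, so there is at least one.
module Submission where

open import Defs
open import Data.Nat using (ℕ; zero; suc; _+_; _∸_; _≤_; _<_; z≤n; s≤s)
open import Data.Nat.Properties using (≤-refl; ≤-trans; m∸n≤m; n∸n≡0; m∸[m∸n]≡n; +-∸-assoc)
open import Data.Fin using (Fin)
open import Data.List using (List; []; _∷_; _++_; map; concat; length; take)
open import Data.List.Relation.Unary.All using (All; []; _∷_)
open import Data.List.Relation.Binary.Permutation.Propositional using (↭-refl)
open import Data.Product using (Σ; _×_; _,_; proj₁; proj₂)
open import Relation.Binary.PropositionalEquality using (_≡_; _≢_; refl; sym; cong; subst)

n<m⇒m∸n≡1+[m∸[1+n]] : ∀ {m n} → n < m → m ∸ n ≡ suc (m ∸ suc n)
n<m⇒m∸n≡1+[m∸[1+n]] {suc m} (s≤s n≤m) = +-∸-assoc 1 n≤m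

-- ls = (ℓ_{q+1}, …, ℓ_s); in particular AdmissibleFrom s 0 is Admissible s.
AdmissibleFrom : ℕ → ℕ → List ℕ → Set
AdmissibleFrom s q ls = (length ls ≡ s ∸ q) × All (0 <_) (take (s ∸ 1 ∸ q) ls)

module _ {s : ℕ} where

  admissibleFrom-last : ∀ {a} → 1 ≤ s → AdmissibleFrom s (s ∸ 1) (a ∷ [])
  admissibleFrom-last {a} 1≤s =
    sym (m∸[m∸n]≡n 1≤s) , subst (λ r → All (0 <_) (take r (a ∷ []))) (sym (n∸n≡0 (s ∸ 1))) []

  admissibleFrom-∷ : ∀ {q a ls} → 0 < a → suc q ≤ s ∸ 1 →
    AdmissibleFrom s (suc q) ls → AdmissibleFrom s q (a ∷ ls)
  admissibleFrom-∷ {q} {a} {ls} 0<a q<s∸1 (length≡ , positive) =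
    subst (suc (length ls) ≡_) (sym (n<m⇒m∸n≡1+[m∸[1+n]] q<s)) (cong suc length≡) ,
    subst (λ r → All (0 <_) (take r (a ∷ ls))) (sym (n<m⇒m∸n≡1+[m∸[1+n]] q<s∸1)) (0<a ∷ positive)
    where
      q<s : q < s
      q<s = ≤-trans q<s∸1 (m∸n≤m s 1)

  admissibleFrom-suc-head : ∀ {q a ls} → AdmissibleFrom s q (a ∷ ls) → AdmissibleFrom s q (suc a ∷ ls)
  admissibleFrom-suc-head {q} {a} {ls} (length≡ , positive) =
    length≡ , positive-head (s ∸ 1 ∸ q) positive
    where
      positive-head : ∀ r → All (0 <_) (take r (a ∷ ls)) → All (0 <_) (take r (suc a ∷ ls))
      positive-head zero    _             = []
      positive-head (suc r) (_ ∷ positive) = s≤s z≤n ∷ positive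

  record SuffixWord (q : ℕ) (w : List ℕ) : Set where
    constructor suffixWord
    field
      leading            : ℕ
      trailing           : List ℕ
      blocks             : List (List ℕ)
      partial-admissible : AdmissibleFrom s q (leading ∷ trailing)
      blocks-admissible  : All (Admissible s) blocks
      word-≡             : w ≡ blockWordFrom (suc q) (leading ∷ trailing)
                                 ++ concat (map blockWord blocks)

  suffixWord-[] : 1 ≤ s → SuffixWord (s ∸ 1) []
  suffixWord-[] 1≤s = suffixWord 0 [] [] (admissibleFrom-last 1≤s) [] refl

  suffixWord-loop : ∀ {q w} → SuffixWord q w → SuffixWord q (suc q ∷ w)
  suffixWord-loop {q} (suffixWord a ls bs adm bs-adm w≡) =
    suffixWord (suc a) ls bs (admissibleFrom-suc-head {q} adm) bs-adm (cong (suc q ∷_) w≡)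

  suffixWord-forward : ∀ {q w} → suc q ≤ s ∸ 1 → SuffixWord (suc q) w → SuffixWord q (suc q ∷ w)
  suffixWord-forward {q} q<s∸1 (suffixWord a ls bs adm bs-adm w≡) =
    suffixWord 1 (a ∷ ls) bs (admissibleFrom-∷ (s≤s z≤n) q<s∸1 adm) bs-adm (cong (suc q ∷_) w≡)

  suffixWord-restart : ∀ {q a ls w} → AdmissibleFrom s q (a ∷ ls) →
    SuffixWord 0 w → SuffixWord q (blockWordFrom (suc q) (a ∷ ls) ++ w)
  suffixWord-restart {q} {a} {ls} adm (suffixWord b bs blocks adm₀ blocks-adm w≡) =
    suffixWord a ls ((b ∷ bs) ∷ blocks) adm (adm₀ ∷ blocks-adm)
      (cong (blockWordFrom (suc q) (a ∷ ls) ++_) w≡)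

-- Writing s = 2 + r makes s ∸ 1 and s ∸ 2 in the edge labels reduce to 1 + r and r.
suffixWord-path : ∀ {r n q m} (ρ : Path (2 + r) n q m (1 + r)) →
  SuffixWord {2 + r} q (proj₂ (transformed ρ))
suffixWord-path []           = suffixWord-[] (s≤s z≤n)
suffixWord-path (loop _ ∷ ρ) = suffixWord-loop (suffixWord-path ρ)
suffixWord-path (fwd p ∷ ρ)  = suffixWord-forward p (suffixWord-path ρ)
suffixWord-path {r} (back1 ∷ ρ) = suffixWord-restart {q = r} penultimate (suffixWord-path ρ)
  where
    penultimate : AdmissibleFrom (2 + r) r (1 ∷ 0 ∷ [])
    penultimate = admissibleFrom-∷ {2 + r} (s≤s z≤n) ≤-refl (admissibleFrom-last {2 + r} (s≤s z≤n))
suffixWord-path {r} (back2 ∷ ρ) =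
  suffixWord-restart (admissibleFrom-last {2 + r} (s≤s z≤n)) (suffixWord-path ρ)

mainTheorem5 : (s n : ℕ) → 2 ≤ s → 1 ≤ n →
    (m : List (Fin n)) → m ≢ [] → (ρ : Path s n 0 m (s ∸ 1)) →
    Σ (List (CVar n)) λ cm → Σ (List (List ℕ)) λ blocks →
    (blocks ≢ []) × All (Admissible s) blocks ×
    (transformed ρ ≈M (cm , concat (map blockWord blocks)))
mainTheorem5 _ _ (s≤s (s≤s z≤n)) _ _ _ ρ with suffixWord-path ρ
... | suffixWord a ls blocks adm blocks-adm w≡ =
  proj₁ (transformed ρ) , (a ∷ ls) ∷ blocks , (λ ()) , adm ∷ blocks-adm , ↭-refl , w≡
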